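{- Let $k\ge1$, $a\in\mathbb{C}$, $c\in\mathbb{C}\setminus\{0\}$ with a fixed value $\ln c$ of its logarithm, and $(x_1,\dots,x_k)\in\mathbb{C}^k$. Then, as power series in $t$, $$E_k\big(t,(x_1+k\ln c,\,cx_2,\dots,c^{k-1}x_k),a\big)=k\ln c+E_k\big(ct,(x_1,x_2,\dots,x_k),a\big).$$
   Context: The complete exponential Bell polynomials $B_n$ are defined by $\exp\left(\sum_{m\ge1}y_mt^m/m!\right)=\sum_{n\ge0}B_n(y_1,\dots,y_n)t^n/n!$. For $\mathbf{x}=(x_1,\dots,x_k)$ the complete exponential autonomous functions of order $k$ are defined by $f_j(\mathbf{x},a)=x_{j+1}$ for $0\le j\le k-1$, $f_k(\mathbf{x},a)=ae^{x_1}$, and $f_{n+k}(\mathbf{x},a)=ae^{x_1}B_n(f_1(\mathbf{x},a),\dots,f_n(\mathbf{x},a))$ for $n\ge1$. Define $E_k(t,\mathbf{x},a)=\sum_{n\ge0}f_n(\mathbf{x},a)t^n/n!$. -}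

module Defs where

open import Level using (_⊔_)
open import Algebra.Bundles using (CommutativeRing)
open import Data.Nat as ℕ using (ℕ; zero; suc; _∸_; _<ᵇ_; _≡ᵇ_; _<?_)
open import Data.Nat.Combinatorics using (_C_)
open import Data.Fin using (Fin; fromℕ<)
import Data.Fin as Fin
open import Data.Bool using (if_then_else_)
open import Relation.Nullary using (yes; no)

module Series {c ℓ} (R : CommutativeRing c ℓ) where
  open CommutativeRing R using (Carrier; _+_; _*_; 0#; 1#)

  _·_ : ℕ → Carrier → Carrier
  zero  · r = 0#
  suc m · r = r + m · r

  _^_ : Carrier → ℕ → Carrier
  r ^ zero  = 1#
  r ^ suc m = r * (r ^ m)

  sumBelow : ℕ → (ℕ → Carrier) → Carrier
  sumBelow zero    g = 0#
  sumBelow (suc n) g = sumBelow n g + g n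

  -- Course-of-values recursion: given step m g, computing the m-th value
  -- from the table g of the values with index < m, returns the sequence.
  table : (ℕ → (ℕ → Carrier) → Carrier) → ℕ → (ℕ → Carrier)
  table step zero    i = 0#
  table step (suc N) i =
    if i <ᵇ N then table step N i
    else (if i ≡ᵇ N then step N (table step N) else 0#)

  cov : (ℕ → (ℕ → Carrier) → Carrier) → ℕ → Carrier
  cov step m = table step (suc m) m

  -- Complete exponential Bell polynomials B_n(y_1,...,y_n), y i = y_i,
  -- via the standard recurrence
  --   B_0 = 1,  B_{n+1} = Σ_{i=0}^{n} (n choose i) y_{i+1} B_{n-i},
  -- which is equivalent to  exp(Σ y_m t^m/m!) = Σ B_n t^n/n!.
  bellStep : (ℕ → Carrier) → ℕ → (ℕ → Carrier) → Carrier
  bellStep y zero    g = 1#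
  bellStep y (suc n) g = sumBelow (suc n) (λ i → ((n C i) · 1#) * (y (suc i) * g (n ∸ i)))

  bell : ℕ → (ℕ → Carrier) → Carrier
  bell n y = cov (bellStep y) n

  -- x_1 (default 0# for k = 0, a case excluded by the theorem)
  x₁ : ∀ {k} → (Fin k → Carrier) → Carrier
  x₁ {zero}  x = 0#
  x₁ {suc k} x = x Fin.zero

  fStep : (exp : Carrier → Carrier) (k : ℕ) → (Fin k → Carrier) → Carrier →
          ℕ → (ℕ → Carrier) → Carrier
  fStep exp k x a m g with m <? k
  ... | yes m<k = x (fromℕ< m<k)
  ... | no  _   with m ∸ k
  ...   | zero  = a * exp (x₁ x)
  ...   | suc n = (a * exp (x₁ x)) * bell (suc n) g

  f : (exp : Carrier → Carrier) (k : ℕ) → (Fin k → Carrier) → Carrier → ℕ → Carrier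
  f exp k x a m = cov (fStep exp k x a) m

  -- E_k(t, x, a) as the sequence of its coefficients f_n (exponential
  -- generating function: coefficient of t^n / n!)
  E : (exp : Carrier → Carrier) (k : ℕ) → (Fin k → Carrier) → Carrier → ℕ → Carrier
  E = f

  -- series operations on egf coefficient sequences:
  -- substitution t ↦ c t multiplies the n-th coefficient by c^n
  scaleVar : Carrier → (ℕ → Carrier) → (ℕ → Carrier)
  scaleVar γ s n = (γ ^ n) * s n

  addConst : Carrier → (ℕ → Carrier) → (ℕ → Carrier)
  addConst L s zero    = L + s zero
  addConst L s (suc n) = s (suc n)

  transformArg : (k : ℕ) → Carrier → Carrier → (Fin k → Carrier) → (Fin k → Carrier)
  transformArg k γ lnγ x Fin.zero    = x Fin.zero + (k · lnγ)
  transformArg k γ lnγ x (Fin.suc i) = (γ ^ suc (Fin.toℕ i)) * x (Fin.suc i)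

-- Substituting t ↦ γ t multiplies the n-th coefficient by γⁿ, so the claim says that f_n is
-- weighted homogeneous of degree n in x_i ↦ γ^(i-1) x_i, except that f_0 = x_1 absorbs the shift.
-- The shift k ln γ only enters through exp x_1, where it produces the factor γᵏ; the Bell
-- polynomial B_n is weighted homogeneous of degree n in y_i ↦ γⁱ y_i, so f_{n+k} = a e^{x_1} B_n
-- picks up γᵏ γⁿ.
module Submission where

open import Defs
open import Level using (Level)
open import Algebra.Bundles using (CommutativeRing)
open import Data.Nat using (ℕ; _≤_)
open import Data.Fin using (Fin)
open import Relation.Nullary using (¬_)
import Data.Nat.Base as Nat
open Nat using (zero; suc; _∸_; _<_; _<ᵇ_; z≤n; s≤s; s<s⁻¹)
open import Data.Nat.Properties
  using (<ᵇ⇒<; <⇒<ᵇ; ≡⇒≡ᵇ; m<1+n⇒m<n∨m≡n; m+[n∸m]≡n; m∸n≤m; m∸n≡0⇒m≤n;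
         ≮⇒≥; ≤-antisym; _<?_; ≤-refl; ≤-trans; <⇒≤; m<n⇒m<1+n; +-mono-≤)
open import Data.Fin.Base using (fromℕ<)
import Data.Fin.Base as Fin
open import Data.Fin.Properties using (toℕ-fromℕ<)
open import Data.Nat.Combinatorics using (_C_)
open import Data.Bool.Base using (T; true; false)
open import Data.Bool.Properties using (T-≡)
open import Data.Empty using (⊥-elim)
open import Data.Sum.Base using (inj₁; inj₂)
open import Function.Bundles using (Equivalence)
open import Relation.Nullary using (yes; no)
open import Relation.Binary.PropositionalEquality as ≡ using (_≡_)
import Algebra.Properties.CommutativeSemigroup as CommutativeSemigroupProperties

module CourseOfValues {c ℓ} (R : CommutativeRing c ℓ) where
  open CommutativeRing R using (Carrier)
  open Series R using (table; cov)

  module _ {p} (P : ℕ → Carrier → Carrier → Set p) {step step′ : ℕ → (ℕ → Carrier) → Carrier}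
           (step-preserves : ∀ m g g′ → (∀ i → i < m → P i (g i) (g′ i)) →
                             P m (step m g) (step′ m g′)) where

    table-preserves : ∀ M i → i < M → P i (table step M i) (table step′ M i)
    table-preserves (suc M) i i<1+M with i <ᵇ M in i<ᵇM
    ... | true  = table-preserves M i (<ᵇ⇒< i M (Equivalence.from T-≡ i<ᵇM))
    ... | false with m<1+n⇒m<n∨m≡n i<1+M
    ...   | inj₁ i<M = ⊥-elim (≡.subst T i<ᵇM (<⇒<ᵇ i<M))
    ...   | inj₂ ≡.refl rewrite Equivalence.to T-≡ (≡⇒≡ᵇ i i ≡.refl) =
      step-preserves i (table step i) (table step′ i) (table-preserves i)

    cov-preserves : ∀ m → P m (cov step m) (cov step′ m)
    cov-preserves m = table-preserves (suc m) m ≤-refl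

module Scaling {c ℓ} (R : CommutativeRing c ℓ) where
  open CommutativeRing R
  open Series R
  open CourseOfValues R
  open import Relation.Binary.Reasoning.Setoid setoid
  open CommutativeSemigroupProperties *-commutativeSemigroup using (interchange; x∙yz≈y∙xz)

  ^-distribˡ-+-* : ∀ γ m n → γ ^ (m Nat.+ n) ≈ γ ^ m * γ ^ n
  ^-distribˡ-+-* γ zero    n = sym (*-identityˡ _)
  ^-distribˡ-+-* γ (suc m) n =
    trans (*-congˡ (^-distribˡ-+-* γ m n)) (sym (*-assoc γ (γ ^ m) (γ ^ n)))

  sumBelow-cong : ∀ n {g h} → (∀ i → i < n → g i ≈ h i) → sumBelow n g ≈ sumBelow n h
  sumBelow-cong zero    g≈h = refl
  sumBelow-cong (suc n) g≈h =
    +-cong (sumBelow-cong n (λ i i<n → g≈h i (m<n⇒m<1+n i<n))) (g≈h n ≤-refl)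

  *-distribˡ-sumBelow : ∀ γ n g → γ * sumBelow n g ≈ sumBelow n (λ i → γ * g i)
  *-distribˡ-sumBelow γ zero    g = zeroʳ γ
  *-distribˡ-sumBelow γ (suc n) g =
    trans (distribˡ γ _ _) (+-congʳ (*-distribˡ-sumBelow γ n g))

  bellStep-homogeneous : ∀ γ m {y y′ g g′} →
    (∀ i → 1 ≤ i → i ≤ m → y′ i ≈ γ ^ i * y i) → (∀ i → i < m → g′ i ≈ γ ^ i * g i) →
    bellStep y′ m g′ ≈ γ ^ m * bellStep y m g
  bellStep-homogeneous γ zero    y′≈ g′≈ = sym (*-identityˡ 1#)
  bellStep-homogeneous γ (suc n) {y} {y′} {g} {g′} y′≈ g′≈ = begin
    sumBelow (suc n) (λ i → binom i * (y′ (suc i) * g′ (n ∸ i)))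
      ≈⟨ sumBelow-cong (suc n) term-homogeneous ⟩
    sumBelow (suc n) (λ i → γ ^ suc n * (binom i * (y (suc i) * g (n ∸ i))))
      ≈⟨ *-distribˡ-sumBelow (γ ^ suc n) (suc n) _ ⟨
    γ ^ suc n * sumBelow (suc n) (λ i → binom i * (y (suc i) * g (n ∸ i))) ∎
    where
    binom : ℕ → Carrier
    binom i = (n C i) · 1#

    term-homogeneous : ∀ i → i < suc n →
      binom i * (y′ (suc i) * g′ (n ∸ i)) ≈ γ ^ suc n * (binom i * (y (suc i) * g (n ∸ i)))
    term-homogeneous i (s≤s i≤n) = begin
      binom i * (y′ (suc i) * g′ (n ∸ i))
        ≈⟨ *-congˡ (*-cong (y′≈ (suc i) (s≤s z≤n) (s≤s i≤n)) (g′≈ (n ∸ i) (s≤s (m∸n≤m n i)))) ⟩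
      binom i * ((γ ^ suc i * y (suc i)) * (γ ^ (n ∸ i) * g (n ∸ i)))
        ≈⟨ *-congˡ (interchange _ _ _ _) ⟩
      binom i * ((γ ^ suc i * γ ^ (n ∸ i)) * (y (suc i) * g (n ∸ i)))
        ≈⟨ *-congˡ (*-congʳ (^-distribˡ-+-* γ (suc i) (n ∸ i))) ⟨
      binom i * (γ ^ suc (i Nat.+ (n ∸ i)) * (y (suc i) * g (n ∸ i)))
        ≡⟨ ≡.cong (λ e → binom i * (γ ^ suc e * (y (suc i) * g (n ∸ i)))) (m+[n∸m]≡n i≤n) ⟩
      binom i * (γ ^ suc n * (y (suc i) * g (n ∸ i)))
        ≈⟨ x∙yz≈y∙xz _ _ _ ⟩
      γ ^ suc n * (binom i * (y (suc i) * g (n ∸ i))) ∎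

  bell-homogeneous : ∀ γ n {y y′} → (∀ i → 1 ≤ i → i ≤ n → y′ i ≈ γ ^ i * y i) →
                     bell n y′ ≈ γ ^ n * bell n y
  bell-homogeneous γ n {y} {y′} y′≈ =
    cov-preserves (λ m u v → m ≤ n → v ≈ γ ^ m * u) step-preserves n ≤-refl
    where
    step-preserves : ∀ m g g′ → (∀ i → i < m → i ≤ n → g′ i ≈ γ ^ i * g i) →
                     m ≤ n → bellStep y′ m g′ ≈ γ ^ m * bellStep y m g
    step-preserves m g g′ g′≈ m≤n = bellStep-homogeneous γ m
      (λ i 1≤i i≤m → y′≈ i 1≤i (≤-trans i≤m m≤n))
      (λ i i<m → g′≈ i i<m (≤-trans (<⇒≤ i<m) m≤n))

  transformArg-zero : ∀ {k} γ lnγ (x : Fin k → Carrier) (0<k : 0 < k) →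
    transformArg k γ lnγ x (fromℕ< 0<k) ≈ k · lnγ + γ ^ 0 * x (fromℕ< 0<k)
  transformArg-zero {suc k} γ lnγ x _ = trans (+-comm _ _) (+-congˡ (sym (*-identityˡ _)))

  transformArg-suc : ∀ {k n} γ lnγ (x : Fin k → Carrier) (n+1<k : suc n < k) →
    transformArg k γ lnγ x (fromℕ< n+1<k) ≈ γ ^ suc n * x (fromℕ< n+1<k)
  transformArg-suc {suc k} γ lnγ x n+1<k = reflexive
    (≡.cong (λ i → γ ^ suc i * x (Fin.suc (fromℕ< (s<s⁻¹ n+1<k)))) (toℕ-fromℕ< (s<s⁻¹ n+1<k)))

  module Exponential (exp : Carrier → Carrier) (exp-cong : ∀ {u v} → u ≈ v → exp u ≈ exp v)
                     (exp-+ : ∀ u v → exp (u + v) ≈ exp u * exp v) where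

    -- Only positive multiples: exp 0# ≈ 1# does not follow from the hypotheses on exp.
    exp-·-suc : ∀ m {u v} → exp u ≈ v → exp (suc m · u) ≈ v ^ suc m
    exp-·-suc zero    {u} {v} exp-u = begin
      exp (u + 0#) ≈⟨ exp-cong (+-identityʳ u) ⟩
      exp u        ≈⟨ exp-u ⟩
      v            ≈⟨ *-identityʳ v ⟨
      v * 1#       ∎
    exp-·-suc (suc m) exp-u = trans (exp-+ _ _) (*-cong exp-u (exp-·-suc m exp-u))

    exp-x₁-transformArg : ∀ {k} → 1 ≤ k → ∀ {γ lnγ} → exp lnγ ≈ γ → (x : Fin k → Carrier) →
      exp (x₁ (transformArg k γ lnγ x)) ≈ γ ^ k * exp (x₁ x)
    exp-x₁-transformArg {suc k} _ exp-lnγ x =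
      trans (exp-+ _ _) (trans (*-congˡ (exp-·-suc k exp-lnγ)) (*-comm _ _))

    module Transform (k : ℕ) (1≤k : 1 ≤ k) (a γ lnγ : Carrier) (exp-lnγ : exp lnγ ≈ γ)
                     (x : Fin k → Carrier) where

      x′ : Fin k → Carrier
      x′ = transformArg k γ lnγ x

      -- v is the n-th coefficient of k ln γ + s(γ t) when u is the n-th coefficient of s.
      Transformed : ℕ → Carrier → Carrier → Set ℓ
      Transformed zero    u v = v ≈ k · lnγ + γ ^ 0 * u
      Transformed (suc n) u v = v ≈ γ ^ suc n * u

      leading-transformed : a * exp (x₁ x′) ≈ γ ^ k * (a * exp (x₁ x))
      leading-transformed =
        trans (*-congˡ (exp-x₁-transformArg 1≤k exp-lnγ x)) (x∙yz≈y∙xz _ _ _)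

      fStep-transformed : ∀ n g g′ → (∀ i → i < n → Transformed i (g i) (g′ i)) →
                          Transformed n (fStep exp k x a n g) (fStep exp k x′ a n g′)
      fStep-transformed zero g g′ _ with 0 <? k
      ... | yes 0<k = transformArg-zero γ lnγ x 0<k
      ... | no  0≮k = ⊥-elim (0≮k 1≤k)
      fStep-transformed (suc n) g g′ g′≈ with suc n <? k
      ... | yes n+1<k = transformArg-suc γ lnγ x n+1<k
      ... | no  n+1≮k with suc n ∸ k in n+1∸k
      ...   | zero = ≡.subst (λ m → a * exp (x₁ x′) ≈ γ ^ m * (a * exp (x₁ x)))
                             k≡n+1 leading-transformed
        where
        k≡n+1 : k ≡ suc n
        k≡n+1 = ≤-antisym (≮⇒≥ n+1≮k) (m∸n≡0⇒m≤n n+1∸k)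
      ...   | suc j = begin
        (a * exp (x₁ x′)) * bell (suc j) g′
          ≈⟨ *-cong leading-transformed (bell-homogeneous γ (suc j) g′≈bell) ⟩
        (γ ^ k * (a * exp (x₁ x))) * (γ ^ suc j * bell (suc j) g)
          ≈⟨ interchange _ _ _ _ ⟩
        (γ ^ k * γ ^ suc j) * ((a * exp (x₁ x)) * bell (suc j) g)
          ≈⟨ *-congʳ (^-distribˡ-+-* γ k (suc j)) ⟨
        γ ^ (k Nat.+ suc j) * ((a * exp (x₁ x)) * bell (suc j) g)
          ≡⟨ ≡.cong (λ m → γ ^ m * ((a * exp (x₁ x)) * bell (suc j) g)) n+1≡k+j+1 ⟨
        γ ^ suc n * ((a * exp (x₁ x)) * bell (suc j) g) ∎
        where
        n+1≡k+j+1 : suc n ≡ k Nat.+ suc j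
        n+1≡k+j+1 = ≡.subst (λ d → suc n ≡ k Nat.+ d) n+1∸k (≡.sym (m+[n∸m]≡n (≮⇒≥ n+1≮k)))

        g′≈bell : ∀ i → 1 ≤ i → i ≤ suc j → g′ i ≈ γ ^ i * g i
        g′≈bell (suc i) _ i+1≤j+1 =
          g′≈ (suc i) (≡.subst (suc (suc i) ≤_) (≡.sym n+1≡k+j+1) (+-mono-≤ 1≤k i+1≤j+1))

      E-transformed : ∀ n → E exp k x′ a n ≈ addConst (k · lnγ) (scaleVar γ (E exp k x a)) n
      E-transformed zero    = cov-preserves Transformed fStep-transformed 0
      E-transformed (suc n) = cov-preserves Transformed fStep-transformed (suc n)

mainTheorem6 : ∀ {c ℓ : Level} (R : CommutativeRing c ℓ) →
    let open CommutativeRing R in let open Series R in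
    (exp : Carrier → Carrier) →
    (∀ {u v} → u ≈ v → exp u ≈ exp v) →
    (∀ u v → exp (u + v) ≈ exp u * exp v) →
    (k : ℕ) → 1 ≤ k → (a γ lnγ : Carrier) → ¬ (γ ≈ 0#) → exp lnγ ≈ γ →
    (x : Fin k → Carrier) →
    ∀ n → E exp k (transformArg k γ lnγ x) a n
            ≈ addConst (k · lnγ) (scaleVar γ (E exp k x a)) n
mainTheorem6 R exp exp-cong exp-+ k 1≤k a γ lnγ _ exp-lnγ x = E-transformed
  where open Scaling.Exponential.Transform R exp exp-cong exp-+ k 1≤k a γ lnγ exp-lnγ x
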